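{- The class of finite Urquhart doubly ordered sets does not have the amalgamation property in the class of sets with two transitive relations satisfying condition (U). In particular, the class of Urquhart doubly ordered sets does not have the amalgamation property, and the class of sets with two transitive relations satisfying condition (U) does not have the amalgamation property.
   Context: Condition (U) for two binary relations $\leq_1,\leq_2$ on a set $X$: for all $x,y\in X$, if $x\leq_1 y$ and $x\leq_2 y$ then $x=y$. An Urquhart doubly ordered set is a set with two partial orders $\leq_1,\leq_2$ satisfying (U). Embeddings are injective maps preserving and reflecting both relations. If $\mathcal K\subseteq\mathcal H$ are classes of structures of the same type, $\mathcal K$ has the amalgamation property in $\mathcal H$ if for all $\mathbf A,\mathbf B,\mathbf C\in\mathcal K$ and embeddings $\iota_1:\mathbf C\to\mathbf A$, $\kappa_1:\mathbf C\to\mathbf B$ there exist $\mathbf D\in\mathcal H$ and embeddings $\iota:\mathbf A\to\mathbf D$, $\kappa:\mathbf B\to\mathbf D$ with $\iota\circ\iota_1=\kappa\circ\kappa_1$; $\mathcal K$ has the amalgamation property if it has it in $\mathcal K$. -}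

module Defs where

open import Level using (0ℓ)
open import Data.Nat using (ℕ)
open import Data.Fin using (Fin)
open import Data.Product using (Σ; ∃; _×_; _,_)
open import Relation.Binary.Core using (Rel)
open import Relation.Binary.Definitions using (Transitive)
open import Relation.Binary.Structures using (IsPartialOrder)
open import Relation.Binary.PropositionalEquality using (_≡_)
open import Function.Bundles using (_↔_)
open import Function.Definitions using (Injective)

record DStr : Set₁ where
  field
    Carrier : Set
    _≤₁_    : Rel Carrier 0ℓ
    _≤₂_    : Rel Carrier 0ℓ
open DStr public

CondU : DStr → Set
CondU X = ∀ x y → _≤₁_ X x y → _≤₂_ X x y → x ≡ y

IsUDO : DStr → Set
IsUDO X = IsPartialOrder _≡_ (_≤₁_ X) × IsPartialOrder _≡_ (_≤₂_ X) × CondU X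

IsTransU : DStr → Set
IsTransU X = Transitive (_≤₁_ X) × Transitive (_≤₂_ X) × CondU X

IsFinite : DStr → Set
IsFinite X = ∃ λ (n : ℕ) → Carrier X ↔ Fin n

IsFinUDO : DStr → Set
IsFinUDO X = IsFinite X × IsUDO X

record Emb (X Y : DStr) : Set where
  field
    fun       : Carrier X → Carrier Y
    injective : Injective _≡_ _≡_ fun
    pres₁     : ∀ x y → _≤₁_ X x y → _≤₁_ Y (fun x) (fun y)
    refl₁     : ∀ x y → _≤₁_ Y (fun x) (fun y) → _≤₁_ X x y
    pres₂     : ∀ x y → _≤₂_ X x y → _≤₂_ Y (fun x) (fun y)
    refl₂     : ∀ x y → _≤₂_ Y (fun x) (fun y) → _≤₂_ X x y
open Emb public

APin : (DStr → Set) → (DStr → Set) → Set₁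
APin K H = ∀ (A B C : DStr) → K A → K B → K C →
  (ι₁ : Emb C A) (κ₁ : Emb C B) →
  Σ DStr λ D → H D × Σ (Emb A D) λ ι → Σ (Emb B D) λ κ →
    ∀ c → fun ι (fun ι₁ c) ≡ fun κ (fun κ₁ c)

AP : (DStr → Set) → Set₁
AP K = APin K K

-- Take C = {c, d} with both orders trivial, extend it to A by a point a with
-- a ≤₁ c and a ≤₂ d, and to B by a point b with c ≤₁ b and d ≤₂ b.  In any amalgam D with transitive
-- relations, ι a ≤₁ κ b and ι a ≤₂ κ b, so (U) identifies ι a with κ b; then
-- κ b = ι a ≤₁ ι c = κ c, and reflection along κ gives b ≤₁ c in B, which is
-- false.  The other two non-amalgamation results follow because the classes
-- only grow: finite UDO ⊆ UDO ⊆ transitive-with-(U).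
module Submission where

open import Defs
open import Level using (0ℓ)
open import Data.Empty using (⊥; ⊥-elim)
open import Data.Fin using (Fin; zero; suc; fromℕ; inject₁)
open import Data.Fin.Properties using (inject₁-injective; fromℕ≢inject₁)
open import Data.Product using (_×_; _,_; proj₂)
open import Data.Sum using (_⊎_; inj₁; inj₂)
open import Function using (_∘_; id)
open import Function.Construct.Identity using (↔-id)
open import Function.Definitions using (Injective)
open import Relation.Binary.Core using (Rel)
open import Relation.Binary.Structures using (IsPartialOrder)
open import Relation.Binary.PropositionalEquality
  using (_≡_; _≢_; refl; sym; trans; subst; subst₂; isEquivalence)
open import Relation.Nullary using (¬_)

APin-mono : ∀ {K K′ H H′ : DStr → Set} →
            (∀ {X} → K′ X → K X) → (∀ {X} → H X → H′ X) →
            APin K H → APin K′ H′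
APin-mono K′⊆K H⊆H′ ap A B C kA kB kC ι₁ κ₁
  with ap A B C (K′⊆K kA) (K′⊆K kB) (K′⊆K kC) ι₁ κ₁
... | D , hD , ι , κ , commutes = D , H⊆H′ hD , ι , κ , commutes

IsUDO⇒IsTransU : ∀ {X} → IsUDO X → IsTransU X
IsUDO⇒IsTransU (po₁ , po₂ , u) = IsPartialOrder.trans po₁ , IsPartialOrder.trans po₂ , u

discrete : Set → DStr
discrete X = record { Carrier = X ; _≤₁_ = _≡_ ; _≤₂_ = _≡_ }

≡-isPartialOrder : {X : Set} → IsPartialOrder {A = X} _≡_ _≡_
≡-isPartialOrder = record
  { isPreorder = record { isEquivalence = isEquivalence ; reflexive = id ; trans = trans }
  ; antisym    = λ x≡y _ → x≡y
  }

discrete-isUDO : (X : Set) → IsUDO (discrete X)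
discrete-isUDO X = ≡-isPartialOrder , ≡-isPartialOrder , λ _ _ x≡y _ → x≡y

data Arrow {X : Set} (u v : X) : Rel X 0ℓ where
  self : ∀ {x} → Arrow u v x x
  edge : Arrow u v u v

module _ {X : Set} {u v : X} where

  Arrow-isPartialOrder : IsPartialOrder _≡_ (Arrow u v)
  Arrow-isPartialOrder = record
    { isPreorder = record
      { isEquivalence = isEquivalence
      ; reflexive     = λ { refl → self }
      ; trans         = Arrow-trans
      }
    ; antisym = Arrow-antisym
    }
    where
    Arrow-trans : ∀ {x y z} → Arrow u v x y → Arrow u v y z → Arrow u v x z
    Arrow-trans self q    = q
    Arrow-trans edge self = edge
    Arrow-trans edge edge = edge

    Arrow-antisym : ∀ {x y} → Arrow u v x y → Arrow u v y x → x ≡ y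
    Arrow-antisym self _    = refl
    Arrow-antisym edge self = refl
    Arrow-antisym edge edge = refl

  Arrow-inversion : ∀ {x y} → Arrow u v x y → x ≡ y ⊎ (x ≡ u × y ≡ v)
  Arrow-inversion self = inj₁ refl
  Arrow-inversion edge = inj₂ (refl , refl)

  Arrow-on-image : ∀ {Y : Set} {f : Y → X} → Injective _≡_ _≡_ f →
                   (∀ y → f y ≢ u) ⊎ (∀ y → f y ≢ v) →
                   ∀ x y → Arrow u v (f x) (f y) → x ≡ y
  Arrow-on-image f-inj avoids x y fx≤fy with Arrow-inversion fx≤fy
  ... | inj₁ fx≡fy = f-inj fx≡fy
  ... | inj₂ (fx≡u , fy≡v) with avoids
  ...   | inj₁ ∉u = ⊥-elim (∉u x fx≡u)
  ...   | inj₂ ∉v = ⊥-elim (∉v y fy≡v)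

twoArrows : {X : Set} → X → X → X → X → DStr
twoArrows {X} u₁ v₁ u₂ v₂ = record { Carrier = X ; _≤₁_ = Arrow u₁ v₁ ; _≤₂_ = Arrow u₂ v₂ }

module _ {X : Set} {u₁ v₁ u₂ v₂ : X} where

  twoArrows-isUDO : ¬ (u₁ ≡ u₂ × v₁ ≡ v₂) → IsUDO (twoArrows u₁ v₁ u₂ v₂)
  twoArrows-isUDO distinct = Arrow-isPartialOrder , Arrow-isPartialOrder , condU
    where
    condU : CondU (twoArrows u₁ v₁ u₂ v₂)
    condU x y x≤₁y x≤₂y with Arrow-inversion x≤₁y | Arrow-inversion x≤₂y
    ... | inj₁ x≡y          | _                 = x≡y
    ... | inj₂ _            | inj₁ x≡y          = x≡y
    ... | inj₂ (refl , refl) | inj₂ (x≡u₂ , y≡v₂) = ⊥-elim (distinct (x≡u₂ , y≡v₂))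

  discrete↪twoArrows : ∀ {Y : Set} {f : Y → X} → Injective _≡_ _≡_ f →
                       (∀ y → f y ≢ u₁) ⊎ (∀ y → f y ≢ v₁) →
                       (∀ y → f y ≢ u₂) ⊎ (∀ y → f y ≢ v₂) →
                       Emb (discrete Y) (twoArrows u₁ v₁ u₂ v₂)
  discrete↪twoArrows {f = f} f-inj avoids₁ avoids₂ = record
    { fun       = f
    ; injective = f-inj
    ; pres₁     = λ { _ _ refl → self }
    ; refl₁     = Arrow-on-image f-inj avoids₁
    ; pres₂     = λ { _ _ refl → self }
    ; refl₂     = Arrow-on-image f-inj avoids₂
    }

module Counterexample where

  c d new : Fin 3
  c   = zero
  d   = suc zero
  new = fromℕ 2

  C A B : DStr
  C = discrete (Fin 2)
  A = twoArrows new c new d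
  B = twoArrows c new d new

  A-isUDO : IsUDO A
  A-isUDO = twoArrows-isUDO λ ()

  B-isUDO : IsUDO B
  B-isUDO = twoArrows-isUDO λ ()

  new∉image : ∀ (y : Fin 2) → inject₁ y ≢ new
  new∉image _ = fromℕ≢inject₁ ∘ sym

  ι₁ : Emb C A
  ι₁ = discrete↪twoArrows inject₁-injective (inj₁ new∉image) (inj₁ new∉image)

  κ₁ : Emb C B
  κ₁ = discrete↪twoArrows inject₁-injective (inj₂ new∉image) (inj₂ new∉image)

  no-transU-amalgam : ∀ D → IsTransU D → (ι : Emb A D) (κ : Emb B D) →
                      (∀ x → fun ι (fun ι₁ x) ≡ fun κ (fun κ₁ x)) → ⊥
  no-transU-amalgam D (trans₁ , trans₂ , condU) ι κ commutes =
    b≰₁c (refl₁ κ b c κb⊑₁κc)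
    where
    open DStr D using () renaming (_≤₁_ to _⊑₁_; _≤₂_ to _⊑₂_)

    a b : Fin 3
    a = new
    b = new

    ιa⊑₁κb : fun ι a ⊑₁ fun κ b
    ιa⊑₁κb = trans₁ (subst (fun ι a ⊑₁_) (commutes zero) (pres₁ ι a c edge))
                    (pres₁ κ c b edge)

    ιa⊑₂κb : fun ι a ⊑₂ fun κ b
    ιa⊑₂κb = trans₂ (subst (fun ι a ⊑₂_) (commutes (suc zero)) (pres₂ ι a d edge))
                    (pres₂ κ d b edge)

    κb⊑₁κc : fun κ b ⊑₁ fun κ c
    κb⊑₁κc = subst₂ _⊑₁_ (condU _ _ ιa⊑₁κb ιa⊑₂κb) (commutes zero) (pres₁ ι a c edge)

    b≰₁c : ¬ Arrow c b b c
    b≰₁c ()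

  finUDO-not-APin-transU : ¬ APin IsFinUDO IsTransU
  finUDO-not-APin-transU ap
    with ap A B C ((3 , ↔-id _) , A-isUDO) ((3 , ↔-id _) , B-isUDO)
                  ((2 , ↔-id _) , discrete-isUDO (Fin 2)) ι₁ κ₁
  ... | D , transU , ι , κ , commutes = no-transU-amalgam D transU ι κ commutes

open Counterexample using (finUDO-not-APin-transU)

corollary5p2 : ¬ APin IsFinUDO IsTransU × ¬ AP IsUDO × ¬ AP IsTransU
corollary5p2 =
    finUDO-not-APin-transU
  , finUDO-not-APin-transU ∘ APin-mono proj₂ IsUDO⇒IsTransU
  , finUDO-not-APin-transU ∘ APin-mono (IsUDO⇒IsTransU ∘ proj₂) id
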